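{- For all $m,n\in\mathbb{N}$ with $m\mid n$ and every $\sigma\in S_n$, there exists $\tau\in S_n$ such that $w(\tau)\le m$, $C_1(\tau)\supseteq C_1(\sigma)$, and $d(\sigma,\tau)\le\frac2m$.
   Context: $S_n$ is the symmetric group on $\{1,\dots,n\}$ with normalized Hamming distance $d(\sigma,\tau)=\frac1n|\{i:\sigma(i)\ne\tau(i)\}|$. For $\sigma\in S_n$ and $l\ge1$, $C_l(\sigma)$ is the set of cycles of $\sigma$ of length $l$ (so $C_1(\sigma)$ is the set of fixed points), and $w(\sigma)$ is the greatest $l$ with $C_l(\sigma)\ne\varnothing$. -}

module Defs where

open import Data.Nat using (ℕ; zero; suc; _≤_; _<_)
open import Data.Fin using (Fin; _≟_)
open import Data.Fin.Permutation using (Permutation′; _⟨$⟩ʳ_)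
open import Data.List using (List; length; filter; allFin)
open import Data.Product using (_×_)
open import Relation.Nullary using (¬_; ¬?)
open import Relation.Binary.PropositionalEquality using (_≡_; _≢_)

iter : ∀ {A : Set} → (A → A) → ℕ → A → A
iter f zero x = x
iter f (suc k) x = f (iter f k x)

CycleLength : ∀ {n} → Permutation′ n → Fin n → ℕ → Set
CycleLength σ i l =
  1 ≤ l × iter (σ ⟨$⟩ʳ_) l i ≡ i ×
  (∀ k → 1 ≤ k → k < l → iter (σ ⟨$⟩ʳ_) k i ≢ i)

-- w(σ) ≤ m : every cycle of σ has length at most m
-- (i.e. C_l(σ) = ∅ for all l > m)
WidthAtMost : ∀ {n} → Permutation′ n → ℕ → Set
WidthAtMost σ m = ∀ i l → CycleLength σ i l → l ≤ m

Fixed : ∀ {n} → Permutation′ n → Fin n → Set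
Fixed σ i = σ ⟨$⟩ʳ i ≡ i

-- number of i with σ(i) ≠ τ(i), i.e. n · d(σ,τ)
hammingCount : ∀ {n} → Permutation′ n → Permutation′ n → ℕ
hammingCount {n} σ τ =
  length (filter (λ i → ¬? ((σ ⟨$⟩ʳ i) ≟ (τ ⟨$⟩ʳ i))) (allFin n))

module Submission where

-- Fix m ≥ 1 and call a point x *short* for σ if σ^k x = x for
-- some 1 ≤ k ≤ m (its cycle has length ≤ m), and *long* otherwise.  If x is
-- long, the points x, σx, …, σ^(m-1)x are distinct and long, and composing σ
-- with the transposition of y = σ^(m-1)x and w = σ⁻¹x cuts them off into
-- the m-cycle (x σx … y).  This cutting step changes σ at the two points y
-- and w only, keeps every short point short (y and w are not short), and
-- hence lowers the number of long points by at least m.  Cutting until no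
-- long point is left yields τ with w(τ) ≤ m which keeps all fixed points of
-- σ, using at most (number of long points)/m steps of cost 2:
-- m · hammingCount σ τ ≤ 2 · #long ≤ 2n.
--
-- Divisibility m ∣ n is only needed for m = 0, where it
-- forces n = 0 and the statement is vacuous.

open import Defs
open import Data.Nat using (ℕ; zero; suc; _+_; _*_; _≤_; _<_; z≤n; s≤s)
open import Data.Nat.Properties hiding (_≟_)
open import Data.Nat.Divisibility using (_∣_; 0∣⇒≡0)
open import Data.Nat.Induction using (<-wellFounded)
open import Data.Fin using (Fin; _≟_)
open import Data.Fin.Properties using (any?)
open import Data.Fin.Permutation using (Permutation′; _⟨$⟩ʳ_; _⟨$⟩ˡ_; inverseˡ; inverseʳ; transpose; _∘ₚ_)
import Data.Fin.Permutation.Components as Components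
open import Data.List using (List; []; _∷_; length; filter; allFin)
open import Data.List.Properties using (length-filter; length-tabulate; filter-accept; filter-none)
open import Data.List.Membership.Propositional using (_∈_)
open import Data.List.Membership.Propositional.Properties using (∈-allFin)
open import Data.List.Relation.Unary.Any using (here; there)
import Data.List.Relation.Unary.All as All
open import Data.List.Relation.Unary.AllPairs using (_∷_)
open import Data.List.Relation.Unary.Unique.Propositional using (Unique)
open import Data.List.Relation.Unary.Unique.Propositional.Properties using (allFin⁺)
open import Data.List.Relation.Binary.Sublist.Propositional using (⊆-refl)
open import Data.List.Relation.Binary.Sublist.Propositional.Properties using (filter⁺; length-mono-≤)
open import Data.Product using (_×_; ∃-syntax; _,_; proj₁; proj₂)
open import Data.Sum using (_⊎_; inj₁; inj₂)
open import Data.Empty using (⊥-elim)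
open import Induction.WellFounded using (Acc; acc)
open import Level using (0ℓ)
open import Relation.Nullary using (¬_; ¬?; Dec; yes; no)
open import Relation.Nullary.Decidable using (dec-true; dec-false; decidable-stable; _⊎-dec_)
open import Relation.Unary using (Pred; Decidable)
open import Relation.Binary.Definitions using (DecidableEquality)
open import Relation.Binary.PropositionalEquality

module Counting {A : Set} where

  count : {P : Pred A 0ℓ} → Decidable P → List A → ℕ
  count P? xs = length (filter P? xs)

  count-hit : {P : Pred A 0ℓ} (P? : Decidable P) {x : A} (xs : List A) →
              P x → count P? (x ∷ xs) ≡ suc (count P? xs)
  count-hit P? xs px = cong length (filter-accept P? px)

  count-∷ : {P : Pred A 0ℓ} (P? : Decidable P) (x : A) (xs : List A) →
            count P? xs ≤ count P? (x ∷ xs)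
  count-∷ P? x xs with P? x
  ... | yes _ = n≤1+n _
  ... | no _  = ≤-refl

  count-none : {P : Pred A 0ℓ} (P? : Decidable P) (xs : List A) →
               All.All (λ x → ¬ P x) xs → count P? xs ≡ 0
  count-none P? xs none = cong length (filter-none P? none)

  count-unique : (y : A) (≟y : ∀ x → Dec (x ≡ y)) (xs : List A) →
                 Unique xs → count ≟y xs ≤ 1
  count-unique y ≟y []       _                = z≤n
  count-unique y ≟y (x ∷ xs) (x∉xs ∷ unique) with ≟y x
  ... | yes refl = s≤s (≤-reflexive (count-none ≟y xs (All.map (λ x≢z z≡x → x≢z (sym z≡x)) x∉xs)))
  ... | no _     = count-unique y ≟y xs unique

  count-∪ : {P Q R : Pred A 0ℓ} (P? : Decidable P) (Q? : Decidable Q) (R? : Decidable R) →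
            (∀ x → P x → Q x ⊎ R x) → ∀ xs → count P? xs ≤ count Q? xs + count R? xs
  count-∪ P? Q? R? P⊆Q∪R [] = z≤n
  count-∪ P? Q? R? P⊆Q∪R (x ∷ xs) with P? x
  ... | no _   = ≤-trans ih (+-mono-≤ (count-∷ Q? x xs) (count-∷ R? x xs))
    where ih = count-∪ P? Q? R? P⊆Q∪R xs
  ... | yes px with P⊆Q∪R x px
  ...   | inj₁ qx = ≤-trans (s≤s ih) (+-mono-≤ (≤-reflexive (sym (count-hit Q? xs qx))) (count-∷ R? x xs))
    where ih = count-∪ P? Q? R? P⊆Q∪R xs
  ...   | inj₂ rx = ≤-trans (s≤s ih) (≤-trans (≤-reflexive (sym (+-suc _ _)))
                      (+-mono-≤ (count-∷ Q? x xs) (≤-reflexive (sym (count-hit R? xs rx)))))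
    where ih = count-∪ P? Q? R? P⊆Q∪R xs

  module _ {P Q : Pred A 0ℓ} (P? : Decidable P) (Q? : Decidable Q) (P⊆Q : ∀ x → P x → Q x) where

    count-mono : ∀ xs → count P? xs ≤ count Q? xs
    count-mono xs = length-mono-≤ (filter⁺ P? Q? (λ { refl → P⊆Q _ }) (⊆-refl {x = xs}))

    count-extend : ∀ {z} xs → z ∈ xs → Q z → ¬ P z → count P? xs < count Q? xs
    count-extend (x ∷ xs) (here refl) qz ¬pz with P? x | Q? x
    ... | yes pz | _      = ⊥-elim (¬pz pz)
    ... | no _   | no ¬qz = ⊥-elim (¬qz qz)
    ... | no _   | yes _  = s≤s (count-mono xs)
    count-extend (x ∷ xs) (there z∈xs) qz ¬pz with P? x | Q? x
    ... | yes px | no ¬qx = ⊥-elim (¬qx (P⊆Q x px))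
    ... | yes _  | yes _  = s≤s (count-extend xs z∈xs qz ¬pz)
    ... | no _   | yes _  = m≤n⇒m≤1+n (count-extend xs z∈xs qz ¬pz)
    ... | no _   | no _   = count-extend xs z∈xs qz ¬pz

  count-gain : DecidableEquality A → (p : ℕ → A) (xs : List A) (k : ℕ) →
               (∀ j → p j ∈ xs) → (∀ i j → i < j → j < k → p i ≢ p j) →
               {P Q : Pred A 0ℓ} (P? : Decidable P) (Q? : Decidable Q) → (∀ x → P x → Q x) →
               (∀ j → j < k → Q (p j) × ¬ P (p j)) → count P? xs + k ≤ count Q? xs
  count-gain _≟ₐ_ p xs zero _ _ P? Q? P⊆Q _ =
    ≤-trans (≤-reflexive (+-identityʳ _)) (count-mono P? Q? P⊆Q xs)
  count-gain _≟ₐ_ p xs (suc k) p∈xs distinct {P} {Q} P? Q? P⊆Q new = begin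
      count P? xs + suc k    ≡⟨ +-suc _ k ⟩
      suc (count P? xs) + k  ≤⟨ +-monoˡ-≤ k (count-extend P? P′? (λ _ → inj₁) xs (p∈xs k) (inj₂ refl) (proj₂ (new k ≤-refl))) ⟩
      count P′? xs + k       ≤⟨ count-gain _≟ₐ_ p xs k p∈xs distinct′ P′? Q? P′⊆Q new′ ⟩
      count Q? xs            ∎
    where
    open ≤-Reasoning
    P′ : Pred A 0ℓ
    P′ x = P x ⊎ x ≡ p k
    P′? : Decidable P′
    P′? x = P? x ⊎-dec (x ≟ₐ p k)
    P′⊆Q : ∀ x → P′ x → Q x
    P′⊆Q x (inj₁ px)   = P⊆Q x px
    P′⊆Q x (inj₂ refl) = proj₁ (new k ≤-refl)
    distinct′ : ∀ i j → i < j → j < k → p i ≢ p j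
    distinct′ i j i<j j<k = distinct i j i<j (m≤n⇒m≤1+n j<k)
    new′ : ∀ j → j < k → Q (p j) × ¬ P′ (p j)
    new′ j j<k = proj₁ (new j (m≤n⇒m≤1+n j<k)) , λ
      { (inj₁ pj)  → proj₂ (new j (m≤n⇒m≤1+n j<k)) pj
      ; (inj₂ pj≡pk) → distinct j k j<k ≤-refl pj≡pk }

open Counting

module Transposition {n : ℕ} (y w : Fin n) where

  t : Fin n → Fin n
  t = Components.transpose y w

  t-y : t y ≡ w
  t-y rewrite dec-true (y ≟ y) refl = refl

  t-fixes : ∀ i → i ≢ y → i ≢ w → t i ≡ i
  t-fixes i i≢y i≢w rewrite dec-false (i ≟ y) i≢y | dec-false (i ≟ w) i≢w = refl

  t-moves : ∀ i → t i ≢ i → i ≡ y ⊎ i ≡ w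
  t-moves i ti≢i = decide (i ≟ y) (i ≟ w)
    where
    decide : Dec (i ≡ y) → Dec (i ≡ w) → i ≡ y ⊎ i ≡ w
    decide (yes i≡y) _         = inj₁ i≡y
    decide (no _)    (yes i≡w) = inj₂ i≡w
    decide (no i≢y)  (no i≢w)  = ⊥-elim (ti≢i (t-fixes i i≢y i≢w))

module Iteration {A : Set} (f : A → A) where

  iter-+ : ∀ a b x → iter f (a + b) x ≡ iter f a (iter f b x)
  iter-+ zero    b x = refl
  iter-+ (suc a) b x = cong f (iter-+ a b x)

  iter-comm : ∀ a b x → iter f a (iter f b x) ≡ iter f b (iter f a x)
  iter-comm a b x = begin
    iter f a (iter f b x) ≡⟨ iter-+ a b x ⟨
    iter f (a + b) x      ≡⟨ cong (λ c → iter f c x) (+-comm a b) ⟩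
    iter f (b + a) x      ≡⟨ iter-+ b a x ⟩
    iter f b (iter f a x) ∎
    where open ≡-Reasoning

  iter-injective : (∀ {x y} → f x ≡ f y → x ≡ y) → ∀ k {x y} → iter f k x ≡ iter f k y → x ≡ y
  iter-injective inj zero    e = e
  iter-injective inj (suc k) e = iter-injective inj k (inj e)

  iter-periodic : ∀ c a x → iter f c x ≡ x → iter f c (iter f a x) ≡ iter f a x
  iter-periodic c a x e = trans (iter-comm c a x) (cong (iter f a) e)

  iter-agree : ∀ (g : A → A) k x → (∀ a → a < k → g (iter f a x) ≡ f (iter f a x)) →
               ∀ b → b ≤ k → iter g b x ≡ iter f b x
  iter-agree g k x agree zero    _   = refl
  iter-agree g k x agree (suc b) b<k =
    trans (cong g (iter-agree g k x agree b (<⇒≤ b<k))) (agree b b<k)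

module _ {n : ℕ} where

  hamming-refl : (σ : Permutation′ n) → hammingCount σ σ ≡ 0
  hamming-refl σ = count-none _ (allFin n) (All.universal (λ i σi≢σi → σi≢σi refl) _)

  hamming-triangle : (σ ρ τ : Permutation′ n) → hammingCount σ τ ≤ hammingCount σ ρ + hammingCount ρ τ
  hamming-triangle σ ρ τ = count-∪ _ _ _ split (allFin n)
    where
    split : ∀ i → σ ⟨$⟩ʳ i ≢ τ ⟨$⟩ʳ i → σ ⟨$⟩ʳ i ≢ ρ ⟨$⟩ʳ i ⊎ ρ ⟨$⟩ʳ i ≢ τ ⟨$⟩ʳ i
    split i σi≢τi with σ ⟨$⟩ʳ i ≟ ρ ⟨$⟩ʳ i
    ... | yes σi≡ρi = inj₂ (λ ρi≡τi → σi≢τi (trans σi≡ρi ρi≡τi))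
    ... | no σi≢ρi  = inj₁ σi≢ρi

  hamming-transpose : (σ : Permutation′ n) (y w : Fin n) → hammingCount σ (transpose y w ∘ₚ σ) ≤ 2
  hamming-transpose σ y w =
    ≤-trans (count-∪ _ (_≟ y) (_≟ w) moved (allFin n))
            (+-mono-≤ (count-unique y (_≟ y) (allFin n) (allFin⁺ n))
                      (count-unique w (_≟ w) (allFin n) (allFin⁺ n)))
    where
    open Transposition y w
    moved : ∀ i → σ ⟨$⟩ʳ i ≢ σ ⟨$⟩ʳ t i → i ≡ y ⊎ i ≡ w
    moved i σi≢σti = t-moves i (λ ti≡i → σi≢σti (cong (σ ⟨$⟩ʳ_) (sym ti≡i)))

module CycleCutting (m′ : ℕ) {n : ℕ} where

  m : ℕ
  m = suc m′

  Short : Permutation′ n → Fin n → Set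
  Short σ x = ∃[ k ] (k < m × iter (σ ⟨$⟩ʳ_) (suc k) x ≡ x)

  Long : Permutation′ n → Fin n → Set
  Long σ x = ¬ Short σ x

  short? : ∀ σ → Decidable (Short σ)
  short? σ x = anyUpTo? (λ k → iter (σ ⟨$⟩ʳ_) (suc k) x ≟ x) m

  long? : ∀ σ → Decidable (Long σ)
  long? σ x = ¬? (short? σ x)

  #long : Permutation′ n → ℕ
  #long σ = count (long? σ) (allFin n)

  #long≤n : ∀ σ → #long σ ≤ n
  #long≤n σ = ≤-trans (length-filter (long? σ) (allFin n)) (≤-reflexive (length-tabulate (λ i → i)))

  all-short⇒width : ∀ σ → (∀ x → Short σ x) → WidthAtMost σ m
  all-short⇒width σ short i l (_ , _ , minimal) with short i
  ... | k , k<m , σ^[1+k]i≡i = ≮⇒≥ (λ m<l → minimal (suc k) (s≤s z≤n) (≤-<-trans k<m m<l) σ^[1+k]i≡i)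

  module _ (σ : Permutation′ n) where
    open Iteration (σ ⟨$⟩ʳ_)

    σ-injective : ∀ {x y} → σ ⟨$⟩ʳ x ≡ σ ⟨$⟩ʳ y → x ≡ y
    σ-injective e = trans (sym (inverseˡ σ)) (trans (cong (σ ⟨$⟩ˡ_) e) (inverseˡ σ))

    short-forward : ∀ j {x} → Short σ x → Short σ (iter (σ ⟨$⟩ʳ_) j x)
    short-forward j {x} (k , k<m , e) = k , k<m , iter-periodic (suc k) j x e

    short-backward : ∀ j {x} → Short σ (iter (σ ⟨$⟩ʳ_) j x) → Short σ x
    short-backward j {x} (k , k<m , e) =
      k , k<m , iter-injective σ-injective j (trans (iter-comm j (suc k) x) e)

  module Cut (σ : Permutation′ n) (x : Fin n) (x-long : Long σ x) where
    f : Fin n → Fin n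
    f = σ ⟨$⟩ʳ_
    open Iteration f

    y w : Fin n
    y = iter f m′ x   -- the last point of the new cycle
    w = σ ⟨$⟩ˡ x
    open Transposition y w

    σ′ : Permutation′ n
    σ′ = transpose y w ∘ₚ σ

    g : Fin n → Fin n
    g = σ′ ⟨$⟩ʳ_

    -- x, f x, …, f^(m-1) x are distinct, since x is long.
    orbit-distinct : ∀ i j → i < j → j < m → iter f i x ≢ iter f j x
    orbit-distinct i j i<j j<m fⁱx≡fʲx with m≤n⇒∃[o]m+o≡n i<j
    ... | o , refl = x-long (o , <-trans (s≤s (m≤n+m o i)) j<m , sym x≡fᵒ⁺¹x)
      where
      x≡fᵒ⁺¹x : x ≡ iter f (suc o) x
      x≡fᵒ⁺¹x = iter-injective (σ-injective σ) i (begin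
        iter f i x                  ≡⟨ fⁱx≡fʲx ⟩
        iter f (suc (i + o)) x      ≡⟨ cong (λ c → iter f c x) (+-suc i o) ⟨
        iter f (i + suc o) x        ≡⟨ iter-+ i (suc o) x ⟩
        iter f i (iter f (suc o) x) ∎)
        where open ≡-Reasoning

    short≢y : ∀ {q} → Short σ q → q ≢ y
    short≢y q-short refl = x-long (short-backward σ m′ q-short)

    short≢w : ∀ {q} → Short σ q → q ≢ w
    short≢w q-short refl = x-long (subst (Short σ) (inverseʳ σ) (short-forward σ 1 q-short))

    -- On the orbit of a short point σ′ agrees with σ; hence short points
    -- stay short and fixed points stay fixed.
    agree-on-short : ∀ {q} → Short σ q → ∀ j → iter g j q ≡ iter f j q
    agree-on-short {q} q-short j = iter-agree g j q agree j ≤-refl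
      where
      agree : ∀ a → a < j → g (iter f a q) ≡ f (iter f a q)
      agree a _ = cong f (t-fixes _ (short≢y (short-forward σ a q-short)) (short≢w (short-forward σ a q-short)))

    long-preserved : ∀ q → Long σ′ q → Long σ q
    long-preserved q q-long′ q-short@(k , k<m , e) = q-long′ (k , k<m , trans (agree-on-short q-short (suc k)) e)

    fixed-preserved : ∀ i → Fixed σ i → Fixed σ′ i
    fixed-preserved i e = trans (agree-on-short (0 , s≤s z≤n , e) 1) e

    new-cycle : ∀ j → j ≤ m′ → iter g j x ≡ iter f j x
    new-cycle = iter-agree g m′ x agree
      where
      agree : ∀ a → a < m′ → g (iter f a x) ≡ f (iter f a x)
      agree a a<m′ = cong f (t-fixes _ (orbit-distinct a m′ a<m′ ≤-refl)
        (λ fᵃx≡w → x-long (a , m≤n⇒m≤1+n a<m′ , trans (cong f fᵃx≡w) (inverseʳ σ))))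

    new-cycle-closes : iter g m x ≡ x
    new-cycle-closes = begin
      g (iter g m′ x) ≡⟨ cong g (new-cycle m′ ≤-refl) ⟩
      f (t y)         ≡⟨ cong f t-y ⟩
      f w             ≡⟨ inverseʳ σ ⟩
      x               ∎
      where open ≡-Reasoning

    orbit-short′ : ∀ j → j < m → Short σ′ (iter f j x)
    orbit-short′ j j<m =
      subst (Short σ′) (new-cycle j (≤-pred j<m)) (short-forward σ′ j (m′ , ≤-refl , new-cycle-closes))

    -- The m points of the new cycle were long and are now short.
    fewer-long : #long σ′ + m ≤ #long σ
    fewer-long = count-gain _≟_ (λ j → iter f j x) (allFin n) m (λ j → ∈-allFin _) orbit-distinct
      (long? σ′) (long? σ) long-preserved
      (λ j j<m → (λ fʲx-short → x-long (short-backward σ j fʲx-short)) , λ long′ → long′ (orbit-short′ j j<m))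

    cost : hammingCount σ σ′ ≤ 2
    cost = hamming-transpose σ y w

  -- Bookkeeping of one cutting step: its cost 2 is paid by the m long points removed.
  cost-bound : ∀ {d d′ l l′} → d ≤ 2 + d′ → m * d′ ≤ 2 * l′ → l′ + m ≤ l → m * d ≤ 2 * l
  cost-bound {d} {d′} {l} {l′} d≤2+d′ md′≤2l′ l′+m≤l = begin
    m * d            ≤⟨ *-monoʳ-≤ m d≤2+d′ ⟩
    m * (2 + d′)     ≡⟨ *-distribˡ-+ m 2 d′ ⟩
    m * 2 + m * d′   ≤⟨ +-monoʳ-≤ (m * 2) md′≤2l′ ⟩
    m * 2 + 2 * l′   ≡⟨ cong (_+ 2 * l′) (*-comm m 2) ⟩
    2 * m + 2 * l′   ≡⟨ *-distribˡ-+ 2 m l′ ⟨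
    2 * (m + l′)     ≡⟨ cong (2 *_) (+-comm m l′) ⟩
    2 * (l′ + m)     ≤⟨ *-monoʳ-≤ 2 l′+m≤l ⟩
    2 * l            ∎
    where open ≤-Reasoning

  cut-all : ∀ σ → Acc _<_ (#long σ) →
            ∃[ τ ] (WidthAtMost τ m × (∀ i → Fixed σ i → Fixed τ i) × m * hammingCount σ τ ≤ 2 * #long σ)
  cut-all σ (acc smaller) with any? (long? σ)
  ... | no no-long =
    σ , all-short⇒width σ (λ x → decidable-stable (short? σ x) (λ x-long → no-long (x , x-long)))
      , (λ i e → e) , ≤-trans (≤-reflexive (trans (cong (m *_) (hamming-refl σ)) (*-zeroʳ m))) z≤n
  ... | yes (x , x-long) =
    let (τ , width , fixed , cost-τ) = cut-all σ′ (smaller (<-≤-trans (m<m+n (#long σ′) (s≤s z≤n)) fewer-long))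
    in τ , width , (λ i e → fixed i (fixed-preserved i e)) ,
       cost-bound (≤-trans (hamming-triangle σ σ′ τ) (+-monoˡ-≤ _ cost)) cost-τ fewer-long
    where open Cut σ x x-long

  width-reduction : ∀ σ → ∃[ τ ] (WidthAtMost τ m × (∀ i → Fixed σ i → Fixed τ i) × m * hammingCount σ τ ≤ 2 * n)
  width-reduction σ =
    let (τ , width , fixed , cost) = cut-all σ (<-wellFounded (#long σ))
    in τ , width , fixed , ≤-trans cost (*-monoʳ-≤ 2 (#long≤n σ))

lemma5p2 : ∀ (m n : ℕ) → m ∣ n → (σ : Permutation′ n) →
    ∃[ τ ] (WidthAtMost τ m ×
    (∀ i → Fixed σ i → Fixed τ i) ×
    m * hammingCount σ τ ≤ 2 * n)
lemma5p2 zero n 0∣n σ with 0∣⇒≡0 0∣n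
... | refl = σ , (λ ()) , (λ i e → e) , z≤n
lemma5p2 (suc m′) n _ σ = CycleCutting.width-reduction m′ σ
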